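{- Let $\mathcal{C}$ be a category with finite products and weak equalisers, and consider: (i) every surjection in $\mathcal{C}$ has a section; (ii) for every object $X$ and all arrows $a,b$ with codomain $X$: $a\leq b$ if and only if for all $x\in X$, $x\in_a$ implies $x\in_b$; (iii) for every arrow $r\colon R\to X\times Y$: if for every $x\in X$ there is $y\in Y$ with $\langle x,y\rangle\in_r$, then there is an arrow $f\colon X\to Y$ such that $\langle x,fx\rangle\in_r$ for all $x\in X$. Then (i) and (ii) are equivalent and imply (iii). If moreover the terminal object of $\mathcal{C}$ is separating, then (i), (ii), (iii) are all equivalent.
   Context: An arrow $x\colon 1\to X$ from the terminal object is written $x\in X$. For an arrow $f\colon Z\to X$ and $x\in X$, write $x\in_f$ if there is $z\in Z$ with $fz=x$; $f$ is surjective if $x\in_f$ for all $x\in X$. For arrows $a\colon A\to X$, $b\colon B\to X$, $a\leq b$ means there is $h\colon A\to B$ with $bh=a$. The terminal object is separating if any $f,g\colon X\to Y$ with $fx=gx$ for all $x\in X$ are equal. -}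

module Defs where

open import Level using (Level; _⊔_; suc)
open import Data.Product using (Σ; _×_; _,_)
open import Relation.Binary using (IsEquivalence)

record Category (o ℓ e : Level) : Set (suc (o ⊔ ℓ ⊔ e)) where
  infixr 9 _∘_
  infix  4 _≈_
  field
    Obj   : Set o
    Hom   : Obj → Obj → Set ℓ
    _≈_   : ∀ {A B} → Hom A B → Hom A B → Set e
    id    : ∀ {A} → Hom A A
    _∘_   : ∀ {A B C} → Hom B C → Hom A B → Hom A C
    ≈-equiv : ∀ {A B} → IsEquivalence (_≈_ {A} {B})
    ∘-resp-≈ : ∀ {A B C} {f h : Hom B C} {g i : Hom A B} →
               f ≈ h → g ≈ i → f ∘ g ≈ h ∘ i
    assoc : ∀ {A B C D} {f : Hom A B} {g : Hom B C} {h : Hom C D} →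
            (h ∘ g) ∘ f ≈ h ∘ (g ∘ f)
    identityˡ : ∀ {A B} {f : Hom A B} → id ∘ f ≈ f
    identityʳ : ∀ {A B} {f : Hom A B} → f ∘ id ≈ f

module _ {o ℓ e} (𝒞 : Category o ℓ e) where
  open Category 𝒞

  record FiniteProducts : Set (o ⊔ ℓ ⊔ e) where
    field
      ⊤     : Obj
      !     : ∀ {A} → Hom A ⊤
      !-unique : ∀ {A} (f : Hom A ⊤) → ! ≈ f
      _×ₒ_  : Obj → Obj → Obj
      π₁    : ∀ {A B} → Hom (A ×ₒ B) A
      π₂    : ∀ {A B} → Hom (A ×ₒ B) B
      ⟨_,_⟩ : ∀ {C A B} → Hom C A → Hom C B → Hom C (A ×ₒ B)
      project₁ : ∀ {C A B} {f : Hom C A} {g : Hom C B} → π₁ ∘ ⟨ f , g ⟩ ≈ f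
      project₂ : ∀ {C A B} {f : Hom C A} {g : Hom C B} → π₂ ∘ ⟨ f , g ⟩ ≈ g
      ⟨⟩-unique : ∀ {C A B} {f : Hom C A} {g : Hom C B} {h : Hom C (A ×ₒ B)} →
                  π₁ ∘ h ≈ f → π₂ ∘ h ≈ g → ⟨ f , g ⟩ ≈ h

  record WeakEqualisers : Set (o ⊔ ℓ ⊔ e) where
    field
      Eq   : ∀ {A B} → Hom A B → Hom A B → Obj
      eq   : ∀ {A B} (f g : Hom A B) → Hom (Eq f g) A
      eq-equalises : ∀ {A B} (f g : Hom A B) → f ∘ eq f g ≈ g ∘ eq f g
      factor : ∀ {A B Z} (f g : Hom A B) (h : Hom Z A) → f ∘ h ≈ g ∘ h →
               Σ (Hom Z (Eq f g)) λ k → eq f g ∘ k ≈ h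

module Notions {o ℓ e} (𝒞 : Category o ℓ e) (P : FiniteProducts 𝒞) where
  open Category 𝒞
  open FiniteProducts P

  Elem : Obj → Set ℓ
  Elem X = Hom ⊤ X

  _∈[_] : ∀ {Z X} → Elem X → Hom Z X → Set (ℓ ⊔ e)
  x ∈[ f ] = Σ (Elem _) λ z → f ∘ z ≈ x

  Surjective : ∀ {Z X} → Hom Z X → Set (ℓ ⊔ e)
  Surjective {X = X} f = (x : Elem X) → x ∈[ f ]

  HasSection : ∀ {Z X} → Hom Z X → Set (ℓ ⊔ e)
  HasSection {Z} {X} f = Σ (Hom X Z) λ s → f ∘ s ≈ id

  _≤_ : ∀ {A B X} → Hom A X → Hom B X → Set (ℓ ⊔ e)
  _≤_ {A} {B} a b = Σ (Hom A B) λ h → b ∘ h ≈ a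

  TerminalSeparating : Set (o ⊔ ℓ ⊔ e)
  TerminalSeparating = ∀ {X Y} (f g : Hom X Y) → ((x : Elem X) → f ∘ x ≈ g ∘ x) → f ≈ g

  Cond-i : Set (o ⊔ ℓ ⊔ e)
  Cond-i = ∀ {Z X} (f : Hom Z X) → Surjective f → HasSection f

  Cond-ii : Set (o ⊔ ℓ ⊔ e)
  Cond-ii = ∀ {X A B} (a : Hom A X) (b : Hom B X) →
            (a ≤ b → ((x : Elem X) → x ∈[ a ] → x ∈[ b ])) ×
            (((x : Elem X) → x ∈[ a ] → x ∈[ b ]) → a ≤ b)

  Cond-iii : Set (o ⊔ ℓ ⊔ e)
  Cond-iii = ∀ {R X Y} (r : Hom R (X ×ₒ Y)) →
             ((x : Elem X) → Σ (Elem Y) λ y → ⟨ x , y ⟩ ∈[ r ]) →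
             Σ (Hom X Y) λ f → (x : Elem X) → ⟨ x , f ∘ x ⟩ ∈[ r ]

module Submission where

-- The heart of (i) ⇒ (ii) is the weak pullback of a and b, obtained as a weak
-- equaliser of a ∘ π₁ and b ∘ π₂: inclusion of elements makes its first leg
-- surjective, and a section of that leg exhibits a ≤ b.  (ii) ⇒ (i) is the
-- instance a = id, since f has a section exactly when id ≤ f.  For (i) ⇒ (iii)
-- a section s of π₁ ∘ r turns r into the graph of π₂ ∘ r ∘ s; conversely, for
-- (iii) ⇒ (i) a choice function for the relation ⟨ f , id ⟩ is a section of f
-- on every element, hence a section of f when ⊤ is separating.

open import Defs
open import Data.Product using (_×_; _,_; Σ; proj₁; proj₂)
open import Relation.Binary using (IsEquivalence; Setoid)
import Relation.Binary.Reasoning.Setoid as SetoidReasoning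

module Proposition3p7 {o ℓ e} (𝒞 : Category o ℓ e) (P : FiniteProducts 𝒞) where
  open Category 𝒞
  open FiniteProducts P
  open Notions 𝒞 P

  module ≈ {A B} = IsEquivalence (≈-equiv {A} {B})

  hom-setoid : Obj → Obj → Setoid ℓ e
  hom-setoid A B = record { Carrier = Hom A B ; _≈_ = _≈_ ; isEquivalence = ≈-equiv }

  module HomReasoning {A B} = SetoidReasoning (hom-setoid A B)

  ∘-congˡ : ∀ {A B C} {f : Hom B C} {g h : Hom A B} → g ≈ h → f ∘ g ≈ f ∘ h
  ∘-congˡ p = ∘-resp-≈ ≈.refl p

  ∘-congʳ : ∀ {A B C} {f h : Hom B C} {g : Hom A B} → f ≈ h → f ∘ g ≈ h ∘ g
  ∘-congʳ p = ∘-resp-≈ p ≈.refl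

  pullˡ : ∀ {A B C D} {f : Hom C D} {g : Hom B C} {h : Hom B D} {k : Hom A B} →
          f ∘ g ≈ h → f ∘ (g ∘ k) ≈ h ∘ k
  pullˡ p = ≈.trans (≈.sym assoc) (∘-congʳ p)

  ⟨⟩∘ : ∀ {W C A B} {f : Hom C A} {g : Hom C B} {h : Hom W C} →
        ⟨ f , g ⟩ ∘ h ≈ ⟨ f ∘ h , g ∘ h ⟩
  ⟨⟩∘ = ≈.sym (⟨⟩-unique (pullˡ project₁) (pullˡ project₂))

  ⟨⟩-η : ∀ {C A B} {h : Hom C (A ×ₒ B)} → ⟨ π₁ ∘ h , π₂ ∘ h ⟩ ≈ h
  ⟨⟩-η = ⟨⟩-unique ≈.refl ≈.refl

  ⟨⟩-cong : ∀ {C A B} {f h : Hom C A} {g k : Hom C B} →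
             f ≈ h → g ≈ k → ⟨ f , g ⟩ ≈ ⟨ h , k ⟩
  ⟨⟩-cong f≈h g≈k = ⟨⟩-unique (≈.trans project₁ (≈.sym f≈h)) (≈.trans project₂ (≈.sym g≈k))

  ⟨⟩-injective : ∀ {C A B} {f h : Hom C A} {g k : Hom C B} →
                 ⟨ f , g ⟩ ≈ ⟨ h , k ⟩ → f ≈ h × g ≈ k
  ⟨⟩-injective {f = f} {h} {g} {k} p = component π₁ project₁ project₁ , component π₂ project₂ project₂
    where
    component : ∀ {D} (π : Hom _ D) {u v : Hom _ D} →
                π ∘ ⟨ f , g ⟩ ≈ u → π ∘ ⟨ h , k ⟩ ≈ v → u ≈ v
    component π pu pv = ≈.trans (≈.sym pu) (≈.trans (∘-congˡ p) pv)

  ≤⇒⊆ : ∀ {A B X} {a : Hom A X} {b : Hom B X} →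
        a ≤ b → (x : Elem X) → x ∈[ a ] → x ∈[ b ]
  ≤⇒⊆ (h , bh≈a) x (z , az≈x) = h ∘ z , ≈.trans (pullˡ bh≈a) az≈x

  ii⇒i : Cond-ii → Cond-i
  ii⇒i cii f surj = proj₂ (cii id f) (λ x _ → surj x)

  section⇒graph : ∀ {R X Y} (r : Hom R (X ×ₒ Y)) (s : Hom X R) →
                  (π₁ ∘ r) ∘ s ≈ id → r ∘ s ≈ ⟨ id , π₂ ∘ (r ∘ s) ⟩
  section⇒graph r s π₁rs≈id = begin
      r ∘ s                              ≈⟨ ≈.sym ⟨⟩-η ⟩
      ⟨ π₁ ∘ (r ∘ s) , π₂ ∘ (r ∘ s) ⟩    ≈⟨ ⟨⟩-cong (≈.trans (≈.sym assoc) π₁rs≈id) ≈.refl ⟩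
      ⟨ id , π₂ ∘ (r ∘ s) ⟩              ∎
    where open HomReasoning

  i⇒iii : Cond-i → Cond-iii
  i⇒iii ci {X = X} r total = f , λ x → s ∘ x , chosen x
    where
    π₁r-surjective : Surjective (π₁ ∘ r)
    π₁r-surjective x with total x
    ... | y , z , rz≈xy = z , ≈.trans assoc (≈.trans (∘-congˡ rz≈xy) project₁)
    section : HasSection (π₁ ∘ r)
    section = ci (π₁ ∘ r) π₁r-surjective
    s = proj₁ section
    f = π₂ ∘ (r ∘ s)
    chosen : (x : Elem X) → r ∘ (s ∘ x) ≈ ⟨ x , f ∘ x ⟩
    chosen x = begin
        r ∘ (s ∘ x)         ≈⟨ pullˡ (section⇒graph r s (proj₂ section)) ⟩
        ⟨ id , f ⟩ ∘ x      ≈⟨ ⟨⟩∘ ⟩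
        ⟨ id ∘ x , f ∘ x ⟩  ≈⟨ ⟨⟩-cong identityˡ ≈.refl ⟩
        ⟨ x , f ∘ x ⟩       ∎
      where open HomReasoning

  ∈-reversed-graph : ∀ {Z X} (f : Hom Z X) (x : Elem X) (y : Elem Z) →
                     (f ∘ y ≈ x → ⟨ x , y ⟩ ∈[ ⟨ f , id ⟩ ]) ×
                     (⟨ x , y ⟩ ∈[ ⟨ f , id ⟩ ] → f ∘ y ≈ x)
  ∈-reversed-graph f x y = into , out
    where
    into : f ∘ y ≈ x → ⟨ x , y ⟩ ∈[ ⟨ f , id ⟩ ]
    into fy≈x = y , ≈.trans ⟨⟩∘ (⟨⟩-cong fy≈x identityˡ)
    out : ⟨ x , y ⟩ ∈[ ⟨ f , id ⟩ ] → f ∘ y ≈ x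
    out (w , p) with ⟨⟩-injective (≈.trans (≈.sym ⟨⟩∘) p)
    ... | fw≈x , idw≈y = ≈.trans (∘-congˡ (≈.trans (≈.sym idw≈y) identityˡ)) fw≈x

  iii⇒i : TerminalSeparating → Cond-iii → Cond-i
  iii⇒i separating ciii {Z} {X} f surj = g , separating (f ∘ g) id pointwise
    where
    total : (x : Elem X) → Σ (Elem Z) λ y → ⟨ x , y ⟩ ∈[ ⟨ f , id ⟩ ]
    total x = proj₁ (surj x) , proj₁ (∈-reversed-graph f x _) (proj₂ (surj x))
    choice : Σ (Hom X Z) λ g → (x : Elem X) → ⟨ x , g ∘ x ⟩ ∈[ ⟨ f , id ⟩ ]
    choice = ciii ⟨ f , id ⟩ total
    g = proj₁ choice
    pointwise : (x : Elem X) → (f ∘ g) ∘ x ≈ id ∘ x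
    pointwise x = begin
        (f ∘ g) ∘ x  ≈⟨ assoc ⟩
        f ∘ (g ∘ x)  ≈⟨ proj₂ (∈-reversed-graph f x (g ∘ x)) (proj₂ choice x) ⟩
        x            ≈⟨ ≈.sym identityˡ ⟩
        id ∘ x       ∎
      where open HomReasoning

  module _ (W : WeakEqualisers 𝒞) where
    open WeakEqualisers W

    module WeakPullback {A B X} (a : Hom A X) (b : Hom B X) where
      Pb : Obj
      Pb = Eq (a ∘ π₁) (b ∘ π₂)

      pb₁ : Hom Pb A
      pb₁ = π₁ ∘ eq (a ∘ π₁) (b ∘ π₂)

      pb₂ : Hom Pb B
      pb₂ = π₂ ∘ eq (a ∘ π₁) (b ∘ π₂)

      commutes : a ∘ pb₁ ≈ b ∘ pb₂
      commutes = ≈.trans (≈.sym assoc) (≈.trans (eq-equalises (a ∘ π₁) (b ∘ π₂)) assoc)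

      universal : ∀ {V} (z : Hom V A) (w : Hom V B) → a ∘ z ≈ b ∘ w →
                  Σ (Hom V Pb) λ k → pb₁ ∘ k ≈ z
      universal z w az≈bw with factor (a ∘ π₁) (b ∘ π₂) ⟨ z , w ⟩ equalised
        where
        equalised : (a ∘ π₁) ∘ ⟨ z , w ⟩ ≈ (b ∘ π₂) ∘ ⟨ z , w ⟩
        equalised = begin
            (a ∘ π₁) ∘ ⟨ z , w ⟩  ≈⟨ ≈.trans assoc (∘-congˡ project₁) ⟩
            a ∘ z                 ≈⟨ az≈bw ⟩
            b ∘ w                 ≈⟨ ≈.sym (≈.trans assoc (∘-congˡ project₂)) ⟩
            (b ∘ π₂) ∘ ⟨ z , w ⟩  ∎
          where open HomReasoning
      ... | k , eqk≈⟨z,w⟩ = k , ≈.trans assoc (≈.trans (∘-congˡ eqk≈⟨z,w⟩) project₁)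

      ⊆⇒pb₁-surjective : ((x : Elem X) → x ∈[ a ] → x ∈[ b ]) → Surjective pb₁
      ⊆⇒pb₁-surjective inc z with inc (a ∘ z) (z , ≈.refl)
      ... | w , bw≈az = universal z w (≈.sym bw≈az)

      pb₁-section⇒≤ : HasSection pb₁ → a ≤ b
      pb₁-section⇒≤ (s , pb₁s≈id) = pb₂ ∘ s , (begin
          b ∘ (pb₂ ∘ s)  ≈⟨ pullˡ (≈.sym commutes) ⟩
          (a ∘ pb₁) ∘ s  ≈⟨ assoc ⟩
          a ∘ (pb₁ ∘ s)  ≈⟨ ∘-congˡ pb₁s≈id ⟩
          a ∘ id         ≈⟨ identityʳ ⟩
          a              ∎)
        where open HomReasoning

    i⇒ii : Cond-i → Cond-ii
    i⇒ii ci a b = ≤⇒⊆ , λ inc → pb₁-section⇒≤ (ci pb₁ (⊆⇒pb₁-surjective inc))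
      where open WeakPullback a b

proposition3p7 : ∀ {o ℓ e} (𝒞 : Category o ℓ e) (P : FiniteProducts 𝒞) → WeakEqualisers 𝒞 →
    let open Notions 𝒞 P in
    ((Cond-i → Cond-ii) × (Cond-ii → Cond-i)) ×
    (Cond-i → Cond-iii) ×
    (TerminalSeparating → Cond-iii → Cond-i)
proposition3p7 𝒞 P W = (i⇒ii W , ii⇒i) , i⇒iii , iii⇒i
  where open Proposition3p7 𝒞 P
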